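{- Let $G$ be a bi-block graph and let $H=K_{m,n}$ be a leaf block of $G$ attached to the rest of $G$ at the cut-vertex $v$. Let $G-H$ denote the graph obtained from $G$ by deleting the vertices of $H$ other than $v$. Let $\mathcal{I}$ be a maximum independent set of $G$ and let $\mathcal{I}|_{G-H}=\{u\in\mathcal{I} : u\in V(G-H)\}$. Then: (i) if $v\in\mathcal{I}$, then $\mathcal{I}|_{G-H}$ is a maximum independent set of $G-H$; (ii) if $v\notin\mathcal{I}$ and $\mathcal{I}|_{G-H}$ is not a maximum independent set of $G-H$, then $v\in\mathcal{J}$ for every maximum independent set $\mathcal{J}$ of $G-H$; (iii) $\alpha(G-H)=|\mathcal{I}|_{G-H}|+1$ if $v\notin\mathcal{I}$ and $\mathcal{I}|_{G-H}$ is not a maximum independent set of $G-H$, and $\alpha(G-H)=|\mathcal{I}|_{G-H}|$ otherwise.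
   Context: All graphs are finite, simple and connected. A block is a maximal connected subgraph without a cut-vertex; a leaf block is a block whose deletion does not disconnect the graph (here: a block $H$ meeting the rest of $G$ only in the cut-vertex $v$). A bi-block graph is a connected graph each of whose blocks is a complete bipartite graph. $\alpha(\cdot)$ denotes the independence number; a maximum independent set is an independent set of cardinality equal to the independence number. -}

module Defs where

open import Data.Nat using (ℕ; _≤_)
open import Data.Fin using (Fin)
open import Data.Bool using (Bool; true; false)
open import Data.Fin.Subset public
  using (Subset; _∈_; _∉_; _⊆_; ∁; _∩_; _∪_; _-_; ∣_∣; ⁅_⁆; ⊤; Nonempty; Empty)
open import Data.Product using (Σ; ∃; ∃₂; _×_; _,_)
open import Data.Sum using (_⊎_)
open import Relation.Binary.PropositionalEquality using (_≡_; _≢_)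
open import Relation.Nullary using (¬_)

record Graph (n : ℕ) : Set where
  field
    adj    : Fin n → Fin n → Bool
    sym    : ∀ x y → adj x y ≡ adj y x
    irrefl : ∀ x → adj x x ≡ false
open Graph public

module _ {n : ℕ} (G : Graph n) where

  data Reach (S : Subset n) (a : Fin n) : Fin n → Set where
    here : a ∈ S → Reach S a a
    step : ∀ {b c} → Reach S a b → c ∈ S → adj G b c ≡ true → Reach S a c

  -- The induced subgraph G[S] is connected (the empty graph counts as connected).
  ConnectedOn : Subset n → Set
  ConnectedOn S = ∀ a b → a ∈ S → b ∈ S → Reach S a b

  Connected : Set
  Connected = ConnectedOn ⊤

  NoCutVertexOn : Subset n → Set
  NoCutVertexOn S = ∀ x → x ∈ S → ConnectedOn (S - x)

  CutVertex : Fin n → Set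
  CutVertex v = ¬ ConnectedOn (⊤ - v)

  Block : Subset n → Set
  Block B = Nonempty B × ConnectedOn B × NoCutVertexOn B ×
            (∀ B′ → B ⊆ B′ → ConnectedOn B′ → NoCutVertexOn B′ → B′ ⊆ B)

  CompleteBipartiteOn : Subset n → Set
  CompleteBipartiteOn B =
    Σ (Subset n) λ X → Σ (Subset n) λ Y →
      Empty (X ∩ Y) × (X ∪ Y ≡ B) × Nonempty X × Nonempty Y ×
      (∀ x y → x ∈ B → y ∈ B →
         (adj G x y ≡ true → (x ∈ X × y ∈ Y) ⊎ (x ∈ Y × y ∈ X)) ×
         ((x ∈ X × y ∈ Y) ⊎ (x ∈ Y × y ∈ X) → adj G x y ≡ true))

  BiBlock : Set
  BiBlock = Connected × (∀ B → Block B → CompleteBipartiteOn B)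

  LeafBlockAt : Subset n → Fin n → Set
  LeafBlockAt H v = Block H × v ∈ H × CutVertex v ×
                    (∀ x y → x ∈ H → x ≢ v → adj G x y ≡ true → y ∈ H)

  minusBlock : Subset n → Fin n → Subset n
  minusBlock H v = ∁ H ∪ ⁅ v ⁆

  Independent : Subset n → Set
  Independent I = ∀ x y → x ∈ I → y ∈ I → adj G x y ≡ false

  MaxIndepIn : Subset n → Subset n → Set
  MaxIndepIn S I = I ⊆ S × Independent I ×
                   (∀ J → J ⊆ S → Independent J → ∣ J ∣ ≤ ∣ I ∣)

  IndepNumberIs : Subset n → ℕ → Set
  IndepNumberIs S k = (Σ (Subset n) λ J → J ⊆ S × Independent J × ∣ J ∣ ≡ k) ×
                      (∀ J → J ⊆ S → Independent J → ∣ J ∣ ≤ k)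

-- Let S be the vertex set of G − H and T the part of I lying in H − v.  Every neighbour
-- of H − v outside H − v is v, so for an independent J ⊆ S with v ∉ J, or with v ∈ I
-- (then v has no neighbour in T), the set J ∪ T is again independent, whence
-- |J| + |T| ≤ |I| = |I ∩ S| + |T|.  Applying this to J − v gives α(G − H) ≤ |I ∩ S| + 1
-- for every J.  So I ∩ S is maximum when v ∈ I, a larger set must contain v and has
-- exactly one more element.
module Submission where

open import Defs
open import Data.Nat using (ℕ; suc; _+_; _≤_; _<_; _≤?_; z≤n; s≤s)
open import Data.Nat.Properties
  using (≤-trans; ≤-antisym; ≤-reflexive; +-suc; m≤n⇒m≤1+n; +-cancelʳ-≤; ≰⇒>; <⇒≱; module ≤-Reasoning)
open import Data.Fin using (Fin; zero; suc)
import Data.Fin.Properties as Fin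
open import Data.Fin.Subset using (_─_; inside; outside)
open import Data.Fin.Subset.Properties
open import Data.Bool using (true; false)
open import Data.Bool.Properties using () renaming (_≟_ to _≟ᵇ_)
open import Data.Vec using (_∷_; []; here; there)
open import Data.Product using (_×_; _,_; proj₁; proj₂; ∃)
open import Data.Sum using (_⊎_; inj₁; inj₂)
open import Data.Empty using (⊥-elim)
open import Function using (_∘_)
open import Relation.Nullary using (¬_; Dec; yes; no; contradiction)
open import Relation.Nullary.Decidable using (_×-dec_; _→-dec_)
open import Relation.Binary.PropositionalEquality
  using (_≡_; _≢_; refl; trans; cong) renaming (sym to ≡-sym)

∣p∣≡∣p∩q∣+∣p∩∁q∣ : ∀ {n} (p q : Subset n) → ∣ p ∣ ≡ ∣ p ∩ q ∣ + ∣ p ∩ ∁ q ∣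
∣p∣≡∣p∩q∣+∣p∩∁q∣ []            []            = refl
∣p∣≡∣p∩q∣+∣p∩∁q∣ (inside  ∷ p) (inside  ∷ q) = cong suc (∣p∣≡∣p∩q∣+∣p∩∁q∣ p q)
∣p∣≡∣p∩q∣+∣p∩∁q∣ (inside  ∷ p) (outside ∷ q) =
  trans (cong suc (∣p∣≡∣p∩q∣+∣p∩∁q∣ p q)) (≡-sym (+-suc ∣ p ∩ q ∣ _))
∣p∣≡∣p∩q∣+∣p∩∁q∣ (outside ∷ p) (inside  ∷ q) = ∣p∣≡∣p∩q∣+∣p∩∁q∣ p q
∣p∣≡∣p∩q∣+∣p∩∁q∣ (outside ∷ p) (outside ∷ q) = ∣p∣≡∣p∩q∣+∣p∩∁q∣ p q

∣p∪q∣≡∣p∣+∣q∣ : ∀ {n} (p q : Subset n) → (∀ {x} → x ∈ p → x ∉ q) → ∣ p ∪ q ∣ ≡ ∣ p ∣ + ∣ q ∣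
∣p∪q∣≡∣p∣+∣q∣ []            []            _    = refl
∣p∪q∣≡∣p∣+∣q∣ (inside  ∷ p) (inside  ∷ q) disj = contradiction here (disj here)
∣p∪q∣≡∣p∣+∣q∣ (inside  ∷ p) (outside ∷ q) disj =
  cong suc (∣p∪q∣≡∣p∣+∣q∣ p q λ x∈p x∈q → disj (there x∈p) (there x∈q))
∣p∪q∣≡∣p∣+∣q∣ (outside ∷ p) (inside  ∷ q) disj =
  trans (cong suc (∣p∪q∣≡∣p∣+∣q∣ p q λ x∈p x∈q → disj (there x∈p) (there x∈q)))
        (≡-sym (+-suc ∣ p ∣ ∣ q ∣))
∣p∪q∣≡∣p∣+∣q∣ (outside ∷ p) (outside ∷ q) disj =
  ∣p∪q∣≡∣p∣+∣q∣ p q λ x∈p x∈q → disj (there x∈p) (there x∈q)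

∣p∣≤∣q∣+∣p─q∣ : ∀ {n} (p q : Subset n) → ∣ p ∣ ≤ ∣ q ∣ + ∣ p ─ q ∣
∣p∣≤∣q∣+∣p─q∣ []            []            = z≤n
∣p∣≤∣q∣+∣p─q∣ (inside  ∷ p) (inside  ∷ q) = s≤s (∣p∣≤∣q∣+∣p─q∣ p q)
∣p∣≤∣q∣+∣p─q∣ (inside  ∷ p) (outside ∷ q) =
  ≤-trans (s≤s (∣p∣≤∣q∣+∣p─q∣ p q)) (≤-reflexive (≡-sym (+-suc ∣ q ∣ ∣ p ─ q ∣)))
∣p∣≤∣q∣+∣p─q∣ (outside ∷ p) (inside  ∷ q) = m≤n⇒m≤1+n (∣p∣≤∣q∣+∣p─q∣ p q)
∣p∣≤∣q∣+∣p─q∣ (outside ∷ p) (outside ∷ q) = ∣p∣≤∣q∣+∣p─q∣ p q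

∣p∣≤1+∣p-x∣ : ∀ {n} (p : Subset n) (x : Fin n) → ∣ p ∣ ≤ suc ∣ p - x ∣
∣p∣≤1+∣p-x∣ p x = ≤-trans (∣p∣≤∣q∣+∣p─q∣ p ⁅ x ⁆) (≤-reflexive (cong (_+ ∣ p - x ∣) (∣⁅x⁆∣≡1 x)))

x∉p-x : ∀ {n} (p : Subset n) (x : Fin n) → x ∉ p - x
x∉p-x (_ ∷ p) zero    ()
x∉p-x (_ ∷ p) (suc x) (there x∈p-x) = x∉p-x p x x∈p-x

module _ {n : ℕ} (G : Graph n) where

  independent? : ∀ I → Dec (Independent G I)
  independent? I = Fin.all? λ x → Fin.all? λ y →
    (x ∈? I) →-dec ((y ∈? I) →-dec (adj G x y ≟ᵇ false))

  Independent-⊆ : ∀ {I J} → I ⊆ J → Independent G J → Independent G I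
  Independent-⊆ I⊆J indJ x y x∈I y∈I = indJ x y (I⊆J x∈I) (I⊆J y∈I)

  Independent-∪ : ∀ {I J} → Independent G I → Independent G J →
                  (∀ x y → x ∈ I → y ∈ J → adj G x y ≡ false) → Independent G (I ∪ J)
  Independent-∪ {I} {J} indI indJ noEdge x y x∈I∪J y∈I∪J
    with x∈p∪q⁻ I J x∈I∪J | x∈p∪q⁻ I J y∈I∪J
  ... | inj₁ x∈I | inj₁ y∈I = indI x y x∈I y∈I
  ... | inj₁ x∈I | inj₂ y∈J = noEdge x y x∈I y∈J
  ... | inj₂ x∈J | inj₁ y∈I = trans (Graph.sym G x y) (noEdge y x y∈I x∈J)
  ... | inj₂ x∈J | inj₂ y∈J = indJ x y x∈J y∈J

  MaxIndepIn⇒IndepNumberIs : ∀ {S I} → MaxIndepIn G S I → IndepNumberIs G S ∣ I ∣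
  MaxIndepIn⇒IndepNumberIs {I = I} (I⊆S , indI , maximum) = (I , I⊆S , indI , refl) , maximum

  MaxIndepIn-or-larger : ∀ {S I} → I ⊆ S → Independent G I →
    MaxIndepIn G S I ⊎ ∃ λ J → J ⊆ S × Independent G J × ∣ I ∣ < ∣ J ∣
  MaxIndepIn-or-larger {S} {I} I⊆S indI
    with anySubset? (λ J → (J ⊆? S) ×-dec (independent? J ×-dec (suc ∣ I ∣ ≤? ∣ J ∣)))
  ... | yes larger = inj₂ larger
  ... | no ¬larger = inj₁ (I⊆S , indI , maximum)
    where
    maximum : ∀ J → J ⊆ S → Independent G J → ∣ J ∣ ≤ ∣ I ∣
    maximum J J⊆S indJ with ∣ J ∣ ≤? ∣ I ∣
    ... | yes ∣J∣≤∣I∣ = ∣J∣≤∣I∣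
    ... | no ∣J∣≰∣I∣ = contradiction (≰⇒> ∣J∣≰∣I∣) λ ∣I∣<∣J∣ → ¬larger (J , J⊆S , indJ , ∣I∣<∣J∣)

  larger⇒¬MaxIndepIn : ∀ {S I J} → J ⊆ S → Independent G J → ∣ I ∣ < ∣ J ∣ →
                       ¬ MaxIndepIn G S I
  larger⇒¬MaxIndepIn J⊆S indJ ∣I∣<∣J∣ (_ , _ , maximum) = <⇒≱ ∣I∣<∣J∣ (maximum _ J⊆S indJ)

module LeafBlock {n : ℕ} (G : Graph n) {H : Subset n} {v : Fin n}
                 (leaf : LeafBlockAt G H v) where

  S : Subset n
  S = minusBlock G H v

  ∉S⇒∈H : ∀ {x} → x ∉ S → x ∈ H
  ∉S⇒∈H x∉S = x∉∁p⇒x∈p (x∉S ∘ p⊆p∪q ⁅ v ⁆)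

  ∉S⇒≢v : ∀ {x} → x ∉ S → x ≢ v
  ∉S⇒≢v x∉S refl = x∉S (q⊆p∪q (∁ H) ⁅ v ⁆ (x∈⁅x⁆ v))

  ∈S⇒∉H⊎≡v : ∀ {x} → x ∈ S → x ∉ H ⊎ x ≡ v
  ∈S⇒∉H⊎≡v x∈S with x∈p∪q⁻ (∁ H) ⁅ v ⁆ x∈S
  ... | inj₁ x∈∁H = inj₁ (x∈∁p⇒x∉p x∈∁H)
  ... | inj₂ x∈⁅v⁆ = inj₂ (x∈⁅y⁆⇒x≡y v x∈⁅v⁆)

  edge-into-S⇒≡v : ∀ {x y} → x ∉ S → y ∈ S → adj G x y ≡ true → y ≡ v
  edge-into-S⇒≡v {x} {y} x∉S y∈S xy with ∈S⇒∉H⊎≡v y∈S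
  ... | inj₁ y∉H = contradiction (proj₂ (proj₂ (proj₂ leaf)) x y (∉S⇒∈H x∉S) (∉S⇒≢v x∉S) xy) y∉H
  ... | inj₂ y≡v = y≡v

  module Restriction {I : Subset n} (maxI : MaxIndepIn G ⊤ I) where

    indI : Independent G I
    indI = proj₁ (proj₂ maxI)

    T : Subset n
    T = I ∩ ∁ S

    ∈T⇒∈I : ∀ {x} → x ∈ T → x ∈ I
    ∈T⇒∈I = p∩q⊆p I (∁ S)

    ∈T⇒∉S : ∀ {x} → x ∈ T → x ∉ S
    ∈T⇒∉S = x∈∁p⇒x∉p ∘ p∩q⊆q I (∁ S)

    no-edge-to-T : ∀ {J} → J ⊆ S → v ∉ J ⊎ v ∈ I →
                   ∀ x y → x ∈ J → y ∈ T → adj G x y ≡ false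
    no-edge-to-T J⊆S v∉J⊎v∈I x y x∈J y∈T with adj G y x in yx
    ... | false = trans (Graph.sym G x y) yx
    ... | true with edge-into-S⇒≡v (∈T⇒∉S y∈T) (J⊆S x∈J) yx | v∉J⊎v∈I
    ...   | refl | inj₁ v∉J = contradiction x∈J v∉J
    ...   | refl | inj₂ v∈I = indI x y v∈I (∈T⇒∈I y∈T)

    ∣J∣≤∣I∩S∣ : ∀ J → J ⊆ S → Independent G J → v ∉ J ⊎ v ∈ I → ∣ J ∣ ≤ ∣ I ∩ S ∣
    ∣J∣≤∣I∩S∣ J J⊆S indJ v∉J⊎v∈I = +-cancelʳ-≤ (∣ T ∣) (∣ J ∣) (∣ I ∩ S ∣) (begin
      ∣ J ∣ + ∣ T ∣      ≡⟨ ∣p∪q∣≡∣p∣+∣q∣ J T (λ x∈J x∈T → ∈T⇒∉S x∈T (J⊆S x∈J)) ⟨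
      ∣ J ∪ T ∣          ≤⟨ proj₂ (proj₂ maxI) (J ∪ T) (λ _ → ∈⊤) indJ∪T ⟩
      ∣ I ∣              ≡⟨ ∣p∣≡∣p∩q∣+∣p∩∁q∣ I S ⟩
      ∣ I ∩ S ∣ + ∣ T ∣  ∎)
      where
      open ≤-Reasoning
      indJ∪T : Independent G (J ∪ T)
      indJ∪T = Independent-∪ G indJ (Independent-⊆ G ∈T⇒∈I indI) (no-edge-to-T J⊆S v∉J⊎v∈I)

    ∣J∣≤1+∣I∩S∣ : ∀ J → J ⊆ S → Independent G J → ∣ J ∣ ≤ suc ∣ I ∩ S ∣
    ∣J∣≤1+∣I∩S∣ J J⊆S indJ = ≤-trans (∣p∣≤1+∣p-x∣ J v)
      (s≤s (∣J∣≤∣I∩S∣ (J - v) (J⊆S ∘ p─q⊆p J ⁅ v ⁆) (Independent-⊆ G (p─q⊆p J ⁅ v ⁆) indJ)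
                       (inj₁ (x∉p-x J v))))

    I∩S⊆S : I ∩ S ⊆ S
    I∩S⊆S = p∩q⊆q I S

    indI∩S : Independent G (I ∩ S)
    indI∩S = Independent-⊆ G (p∩q⊆p I S) indI

lemma2p2 : ∀ {N : ℕ} (G : Graph N) (H : Subset N) (v : Fin N) (I : Subset N) →
    BiBlock G → LeafBlockAt G H v → MaxIndepIn G ⊤ I →
      (v ∈ I → MaxIndepIn G (minusBlock G H v) (I ∩ minusBlock G H v)) ×
      (v ∉ I → ¬ MaxIndepIn G (minusBlock G H v) (I ∩ minusBlock G H v) →
         ∀ J → MaxIndepIn G (minusBlock G H v) J → v ∈ J) ×
      ((v ∉ I × ¬ MaxIndepIn G (minusBlock G H v) (I ∩ minusBlock G H v)) →
         IndepNumberIs G (minusBlock G H v) (suc ∣ I ∩ minusBlock G H v ∣)) ×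
      (¬ (v ∉ I × ¬ MaxIndepIn G (minusBlock G H v) (I ∩ minusBlock G H v)) →
         IndepNumberIs G (minusBlock G H v) ∣ I ∩ minusBlock G H v ∣)
lemma2p2 G H v I _ leaf maxI = maxIfIn , ∈everyMax , α≡1+ , α≡
  where
  open LeafBlock G leaf
  open Restriction maxI

  maxIfIn : v ∈ I → MaxIndepIn G S (I ∩ S)
  maxIfIn v∈I = I∩S⊆S , indI∩S , λ J J⊆S indJ → ∣J∣≤∣I∩S∣ J J⊆S indJ (inj₂ v∈I)

  ∈everyMax : v ∉ I → ¬ MaxIndepIn G S (I ∩ S) → ∀ J → MaxIndepIn G S J → v ∈ J
  ∈everyMax _ notMax J (J⊆S , indJ , maxJ) with v ∈? J
  ... | yes v∈J = v∈J
  ... | no v∉J = ⊥-elim (notMax (I∩S⊆S , indI∩S , λ K K⊆S indK →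
          ≤-trans (maxJ K K⊆S indK) (∣J∣≤∣I∩S∣ J J⊆S indJ (inj₁ v∉J))))

  α≡1+ : v ∉ I × ¬ MaxIndepIn G S (I ∩ S) → IndepNumberIs G S (suc ∣ I ∩ S ∣)
  α≡1+ (_ , notMax) with MaxIndepIn-or-larger G I∩S⊆S indI∩S
  ... | inj₁ max = contradiction max notMax
  ... | inj₂ (J , J⊆S , indJ , ∣I∩S∣<∣J∣) =
    (J , J⊆S , indJ , ≤-antisym (∣J∣≤1+∣I∩S∣ J J⊆S indJ) ∣I∩S∣<∣J∣) , ∣J∣≤1+∣I∩S∣

  α≡ : ¬ (v ∉ I × ¬ MaxIndepIn G S (I ∩ S)) → IndepNumberIs G S ∣ I ∩ S ∣
  α≡ notBoth with MaxIndepIn-or-larger G I∩S⊆S indI∩S | v ∈? I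
  ... | inj₁ max | _ = MaxIndepIn⇒IndepNumberIs G max
  ... | inj₂ _ | yes v∈I = MaxIndepIn⇒IndepNumberIs G (maxIfIn v∈I)
  ... | inj₂ (J , J⊆S , indJ , ∣I∩S∣<∣J∣) | no v∉I =
    contradiction (v∉I , larger⇒¬MaxIndepIn G J⊆S indJ ∣I∩S∣<∣J∣) notBoth
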